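{- Let $G_1=([n],E_1)$ and $G_2=([n],E_2)$ be $n$-vertex graphs of pathwidth $k$ and $t$ respectively. Then there exists a permutation $\varphi\in S_n$ such that the union of $G_1$ and $G_2$ along $\varphi$ has pathwidth at most $k+t$.
   Context: $[n]=\{1,\dots,n\}$ and $S_n$ is the group of permutations of $[n]$. For $\varphi\in S_n$ and $E\subseteq\binom{[n]}{2}$, $\varphi(E)=\{\{\varphi(i),\varphi(j)\}:\{i,j\}\in E\}$. The union of $G_1=([n],E_1)$ and $G_2=([n],E_2)$ along $\varphi$ is the graph $([n],\varphi(E_1)\cup E_2)$. -}

module Defs where

open import Level using (0ℓ)
open import Data.Nat using (ℕ; suc; _<_; _≤_)
open import Data.Fin using (Fin) renaming (_≤_ to _≤ᶠ_)
open import Data.Fin.Subset using (Subset; _∈_; ∣_∣)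
open import Data.Fin.Permutation using (Permutation′; _⟨$⟩ʳ_)
open import Data.Product using (Σ; ∃; _×_)
open import Data.Sum using (_⊎_)
open import Relation.Binary.PropositionalEquality using (_≡_)
open import Relation.Nullary using (¬_)

record Graph (n : ℕ) : Set₁ where
  field
    Adj    : Fin n → Fin n → Set
    sym    : ∀ {i j} → Adj i j → Adj j i
    irrefl : ∀ {i} → ¬ Adj i i
open Graph public using (Adj)

-- Union of G₁ and G₂ along φ: edge set φ(E₁) ∪ E₂.
unionAlong : ∀ {n} → Graph n → Graph n → Permutation′ n → Graph n
unionAlong {n} G₁ G₂ φ = record
  { Adj = A
  ; sym = s
  ; irrefl = ir
  }
  where
  A : Fin n → Fin n → Set
  A u v = (∃ λ i → ∃ λ j → Adj G₁ i j × (φ ⟨$⟩ʳ i ≡ u) × (φ ⟨$⟩ʳ j ≡ v)) ⊎ Adj G₂ u v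
  open import Data.Sum using (inj₁; inj₂)
  open import Data.Product using (_,_)
  open import Relation.Binary.PropositionalEquality as P using (refl)
  open import Data.Fin.Permutation using (inverseˡ; _⟨$⟩ˡ_)
  s : ∀ {u v} → A u v → A v u
  s (inj₁ (i , j , e , p , q)) = inj₁ (j , i , Graph.sym G₁ e , q , p)
  s (inj₂ e) = inj₂ (Graph.sym G₂ e)
  ir : ∀ {u} → ¬ A u u
  ir (inj₁ (i , j , e , refl , q)) with P.trans (P.sym (inverseˡ φ {j})) (P.trans (P.cong (φ ⟨$⟩ˡ_) q) (inverseˡ φ {i}))
  ... | refl = Graph.irrefl G₁ e
  ir (inj₂ e) = Graph.irrefl G₂ e

record PathDecomposition {n : ℕ} (G : Graph n) : Set where
  field
    m        : ℕ
    bag      : Fin m → Subset n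
    covers   : ∀ v → ∃ λ i → v ∈ bag i
    edgeIn   : ∀ u v → Adj G u v → ∃ λ i → (u ∈ bag i) × (v ∈ bag i)
    interval : ∀ v (i j l : Fin m) → i ≤ᶠ j → j ≤ᶠ l → v ∈ bag i → v ∈ bag l → v ∈ bag j
open PathDecomposition public

WidthAtMost : ∀ {n} {G : Graph n} → PathDecomposition G → ℕ → Set
WidthAtMost D w = ∀ i → ∣ bag D i ∣ ≤ suc w

PathwidthAtMost : ∀ {n} → Graph n → ℕ → Set
PathwidthAtMost G w = Σ (PathDecomposition G) λ D → WidthAtMost D w

HasPathwidth : ∀ {n} → Graph n → ℕ → Set
HasPathwidth G k = PathwidthAtMost G k × (∀ j → j < k → ¬ PathwidthAtMost G j)

-- A path decomposition of width w can be read as a linear ordering of the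
-- vertices in which, at every position p, at most w vertices placed before p
-- are still active (they share a bag with a vertex at position p or later).
-- Ordering the vertices by the first bag that contains them turns a
-- decomposition into such a layout and the bags {p-th vertex} ∪ active(p) turn
-- a layout back into a decomposition. Given layouts of G₁ and G₂, identify the
-- p-th vertex of G₁ with the p-th vertex of G₂: a vertex active at p in the
-- union is active at p in G₁ or in G₂, so the union has a layout of width k + t.
module Submission where

open import Defs
open import Data.Nat as ℕ using (ℕ; zero; suc; _+_)
import Data.Nat.Properties as ℕ
open import Data.Bool using (Bool; true; false; if_then_else_)
open import Data.Fin using (Fin; zero; suc; toℕ; punchIn; _≤_; _<_)
open import Data.Fin.Properties using (_≟_; ≤-trans; ≤-reflexive; <-irrefl; <-cmp; ≤∧≢⇒<)
open import Data.Fin.Permutation as Perm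
  using (Permutation′; _⟨$⟩ʳ_; _⟨$⟩ˡ_; inverseˡ; inverseʳ; _∘ₚ_)
open import Data.Fin.Subset using (Subset; _∈_; _⊂_; ∣_∣; ⁅_⁆; _∪_; _∩_; ⊥; inside)
open import Data.Fin.Subset.Properties
  using (_∈?_; ∉⊥; x∈⁅x⁆; x∈⁅y⁆⇒x≡y; ∣⁅x⁆∣≡1; x∈p∪q⁺; x∈p∪q⁻; x∈p∩q⁺; p∩q⊆p; p∩q⊆q; p⊂q⇒∣p∣<∣q∣)
open import Data.Vec using ([]; _∷_; here; there; lookup; tabulate)
open import Data.Vec.Properties using (lookup∘tabulate; []=⇒lookup; lookup⇒[]=)
open import Data.Product using (Σ; ∃; _×_; _,_; proj₁; proj₂)
open import Data.Sum using (inj₁; inj₂)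
open import Data.Empty using (⊥-elim)
open import Function using (_∘_)
open import Relation.Binary.Definitions using (tri<; tri≈; tri>)
open import Relation.Binary.PropositionalEquality
open import Relation.Nullary using (yes; no)
open import Relation.Unary using (Pred; Decidable)
open import Algebra.Properties.CommutativeMonoid.Sum ℕ.+-0-commutativeMonoid
  using (sum; sum-cong-≗; sum-permute)

private
  variable
    n n′ : ℕ

preimage : (Fin n′ → Fin n) → Subset n → Subset n′
preimage f S = tabulate (lookup S ∘ f)

∈-preimage⁺ : ∀ {f : Fin n′ → Fin n} {S i} → f i ∈ S → i ∈ preimage f S
∈-preimage⁺ {f = f} {S} {i} fi∈S =
  lookup⇒[]= i (preimage f S) (trans (lookup∘tabulate (lookup S ∘ f) i) ([]=⇒lookup fi∈S))

∈-preimage⁻ : ∀ {f : Fin n′ → Fin n} {S i} → i ∈ preimage f S → f i ∈ S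
∈-preimage⁻ {f = f} {S} {i} i∈f⁻¹S =
  lookup⇒[]= (f i) S (trans (sym (lookup∘tabulate (lookup S ∘ f) i)) ([]=⇒lookup i∈f⁻¹S))

indicator : Bool → ℕ
indicator b = if b then 1 else 0

∣p∣≡∑indicator : (p : Subset n) → ∣ p ∣ ≡ sum (indicator ∘ lookup p)
∣p∣≡∑indicator []          = refl
∣p∣≡∑indicator (true ∷ p)  = cong suc (∣p∣≡∑indicator p)
∣p∣≡∑indicator (false ∷ p) = ∣p∣≡∑indicator p

∣preimage∣ : (π : Permutation′ n) (S : Subset n) → ∣ preimage (π ⟨$⟩ʳ_) S ∣ ≡ ∣ S ∣
∣preimage∣ π S = begin
  ∣ preimage (π ⟨$⟩ʳ_) S ∣                          ≡⟨ ∣p∣≡∑indicator (preimage (π ⟨$⟩ʳ_) S) ⟩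
  sum (indicator ∘ lookup (preimage (π ⟨$⟩ʳ_) S))  ≡⟨ sum-cong-≗ (cong indicator ∘ lookup∘tabulate (lookup S ∘ (π ⟨$⟩ʳ_))) ⟩
  sum (indicator ∘ lookup S ∘ (π ⟨$⟩ʳ_))            ≡⟨ sum-permute (indicator ∘ lookup S) π ⟨
  sum (indicator ∘ lookup S)                        ≡⟨ ∣p∣≡∑indicator S ⟨
  ∣ S ∣                                             ∎
  where open ≡-Reasoning

∣p∪q∣≤∣p∣+∣q∣ : (p q : Subset n) → ∣ p ∪ q ∣ ℕ.≤ ∣ p ∣ + ∣ q ∣
∣p∪q∣≤∣p∣+∣q∣ []          []          = ℕ.z≤n
∣p∪q∣≤∣p∣+∣q∣ (true ∷ p)  (y ∷ q)     = ℕ.s≤s (ℕ.≤-trans (∣p∪q∣≤∣p∣+∣q∣ p q) (ℕ.+-monoʳ-≤ ∣ p ∣ (∣q∣≤∣y∷q∣ y q)))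
  where
  ∣q∣≤∣y∷q∣ : ∀ y (q : Subset n) → ∣ q ∣ ℕ.≤ ∣ y ∷ q ∣
  ∣q∣≤∣y∷q∣ true  q = ℕ.n≤1+n _
  ∣q∣≤∣y∷q∣ false q = ℕ.≤-refl
∣p∪q∣≤∣p∣+∣q∣ (false ∷ p) (true ∷ q)  = ℕ.≤-trans (ℕ.s≤s (∣p∪q∣≤∣p∣+∣q∣ p q)) (ℕ.≤-reflexive (sym (ℕ.+-suc ∣ p ∣ ∣ q ∣)))
∣p∪q∣≤∣p∣+∣q∣ (false ∷ p) (false ∷ q) = ∣p∪q∣≤∣p∣+∣q∣ p q

below : Fin n → Subset n
below zero    = ⊥
below (suc p) = inside ∷ below p

∈-below⁺ : ∀ {p q : Fin n} → q < p → q ∈ below p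
∈-below⁺ {p = suc p} {zero}  _               = here
∈-below⁺ {p = suc p} {suc q} (ℕ.s≤s q<p) = there (∈-below⁺ q<p)

∈-below⁻ : ∀ {p q : Fin n} → q ∈ below p → q < p
∈-below⁻ {p = zero}  q∈⊥             = ⊥-elim (∉⊥ q∈⊥)
∈-below⁻ {p = suc p} here            = ℕ.s≤s ℕ.z≤n
∈-below⁻ {p = suc p} (there q∈below) = ℕ.s≤s (∈-below⁻ q∈below)

least : ∀ {ℓ} {P : Pred (Fin n) ℓ} → Decidable P → ∃ P → Σ (Fin n) λ i → P i × (∀ {j} → P j → i ≤ j)
least {suc n} {P = P} P? (i , Pi) with P? zero
... | yes P0 = zero , P0 , λ _ → ℕ.z≤n
... | no ¬P0 with i | Pi
...   | zero  | P0   = ⊥-elim (¬P0 P0)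
...   | suc i | Psi with least (P? ∘ suc) (i , Psi)
...     | r , Pr , r-least = suc r , Pr , suc-least
  where
  suc-least : ∀ {j} → P j → suc r ≤ j
  suc-least {zero}  P0  = ⊥-elim (¬P0 P0)
  suc-least {suc j} Psj = ℕ.s≤s (r-least Psj)

argmin : (key : Fin (suc n) → ℕ) → Σ (Fin (suc n)) λ v → ∀ u → key v ℕ.≤ key u
argmin {zero}  key = zero , λ { zero → ℕ.≤-refl }
argmin {suc n} key with argmin (key ∘ suc)
... | v , v-min with key zero ℕ.≤? key (suc v)
...   | yes k0≤kv = zero , λ { zero → ℕ.≤-refl ; (suc u) → ℕ.≤-trans k0≤kv (v-min u) }
...   | no  k0≰kv = suc v , λ { zero → ℕ.<⇒≤ (ℕ.≰⇒> k0≰kv) ; (suc u) → v-min u }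

sortingPermutation : (key : Fin n → ℕ) →
  Σ (Permutation′ n) λ π → ∀ {p q} → p ≤ q → key (π ⟨$⟩ʳ p) ℕ.≤ key (π ⟨$⟩ʳ q)
sortingPermutation {zero}  key = Perm.id , λ { {()} }
sortingPermutation {suc n} key with argmin key
... | v , v-min with sortingPermutation (key ∘ punchIn v)
...   | π , π-sorted = Perm.insert zero v π , sorted
  where
  sorted : ∀ {p q} → p ≤ q → key (Perm.insert zero v π ⟨$⟩ʳ p) ℕ.≤ key (Perm.insert zero v π ⟨$⟩ʳ q)
  sorted {zero}  {q}     _           = v-min _
  sorted {suc p} {suc q} (ℕ.s≤s p≤q)
    rewrite Perm.insert-punchIn zero v π p | Perm.insert-punchIn zero v π q = π-sorted p≤q

-- The vertex-separation form of a path decomposition: rank v is the position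
-- of v, and active p are the vertices before position p that are still needed
-- at p.
record LinearLayout (G : Graph n) (w : ℕ) : Set where
  field
    rank            : Permutation′ n
    active          : Fin n → Subset n
    active⇒rank<    : ∀ {v p} → v ∈ active p → rank ⟨$⟩ʳ v < p
    edge⇒active     : ∀ {u v} → Adj G u v → rank ⟨$⟩ʳ u < rank ⟨$⟩ʳ v → u ∈ active (rank ⟨$⟩ʳ v)
    active-interval : ∀ {v j l} → rank ⟨$⟩ʳ v < j → j ≤ l → v ∈ active l → v ∈ active j
    ∣active∣≤       : ∀ p → ∣ active p ∣ ℕ.≤ w

module _ {G : Graph n} {w : ℕ} (D : PathDecomposition G) (D-width : WidthAtMost D w) where

  private
    first-bag : ∀ v → Σ (Fin (m D)) λ i → v ∈ bag D i × (∀ {j} → v ∈ bag D j → i ≤ j)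
    first-bag v = least (λ i → v ∈? bag D i) (covers D v)

    first : Fin n → Fin (m D)
    first v = proj₁ (first-bag v)

    first-∈ : ∀ v → v ∈ bag D (first v)
    first-∈ v = proj₁ (proj₂ (first-bag v))

    first-≤ : ∀ {v c} → v ∈ bag D c → first v ≤ c
    first-≤ {v} = proj₂ (proj₂ (first-bag v))

    π : Permutation′ n
    π = proj₁ (sortingPermutation (toℕ ∘ first))

    first-sorted : ∀ {p q} → p ≤ q → first (π ⟨$⟩ʳ p) ≤ first (π ⟨$⟩ʳ q)
    first-sorted = proj₂ (sortingPermutation (toℕ ∘ first))

    frontier : Fin n → Subset n
    frontier p = bag D (first (π ⟨$⟩ʳ p))

    ∈-frontier : ∀ {u p c} → π ⟨$⟩ˡ u ≤ p → first (π ⟨$⟩ʳ p) ≤ c → u ∈ bag D c → u ∈ frontier p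
    ∈-frontier {u} {p} {c} u≤p p≤c u∈c = interval D u (first u) (first (π ⟨$⟩ʳ p)) c first-u≤ p≤c (first-∈ u) u∈c
      where
      first-u≤ : first u ≤ first (π ⟨$⟩ʳ p)
      first-u≤ = subst (λ x → first x ≤ first (π ⟨$⟩ʳ p)) (inverseʳ π) (first-sorted u≤p)

    active : Fin n → Subset n
    active p = preimage (π ⟨$⟩ˡ_) (below p) ∩ frontier p

    active⇒rank< : ∀ {v p} → v ∈ active p → π ⟨$⟩ˡ v < p
    active⇒rank< v∈p = ∈-below⁻ (∈-preimage⁻ (p∩q⊆p _ _ v∈p))

    edge⇒active : ∀ {u v} → Adj G u v → π ⟨$⟩ˡ u < π ⟨$⟩ˡ v → u ∈ active (π ⟨$⟩ˡ v)
    edge⇒active {u} {v} e u<v with edgeIn D u v e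
    ... | c , u∈c , v∈c = x∈p∩q⁺ (∈-preimage⁺ (∈-below⁺ u<v) , ∈-frontier (ℕ.<⇒≤ u<v) first-v≤c u∈c)
      where
      first-v≤c : first (π ⟨$⟩ʳ (π ⟨$⟩ˡ v)) ≤ c
      first-v≤c = first-≤ (subst (_∈ bag D c) (sym (inverseʳ π)) v∈c)

    active-interval : ∀ {v j l} → π ⟨$⟩ˡ v < j → j ≤ l → v ∈ active l → v ∈ active j
    active-interval v<j j≤l v∈l =
      x∈p∩q⁺ (∈-preimage⁺ (∈-below⁺ v<j) , ∈-frontier (ℕ.<⇒≤ v<j) (first-sorted j≤l) (p∩q⊆q _ _ v∈l))

    -- The vertex at position p lies in frontier p but is not active at p.
    active⊂frontier : ∀ p → active p ⊂ frontier p
    active⊂frontier p = p∩q⊆q _ _ , π ⟨$⟩ʳ p , first-∈ (π ⟨$⟩ʳ p) ,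
      λ πp∈p → <-irrefl (inverseˡ π) (active⇒rank< πp∈p)

    ∣active∣≤ : ∀ p → ∣ active p ∣ ℕ.≤ w
    ∣active∣≤ p = ℕ.s≤s⁻¹ (ℕ.≤-trans (p⊂q⇒∣p∣<∣q∣ (active⊂frontier p)) (D-width _))

  pathDecomposition⇒linearLayout : LinearLayout G w
  pathDecomposition⇒linearLayout = record
    { rank            = Perm.flip π
    ; active          = active
    ; active⇒rank<    = active⇒rank<
    ; edge⇒active     = edge⇒active
    ; active-interval = active-interval
    ; ∣active∣≤       = ∣active∣≤
    }

module _ {G : Graph n} {w : ℕ} (L : LinearLayout G w) where

  open LinearLayout L

  private
    layoutBag : Fin n → Subset n
    layoutBag p = ⁅ rank ⟨$⟩ˡ p ⁆ ∪ active p

    ∈-layoutBag : ∀ v → v ∈ layoutBag (rank ⟨$⟩ʳ v)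
    ∈-layoutBag v = x∈p∪q⁺ (inj₁ (subst (λ x → v ∈ ⁅ x ⁆) (sym (inverseˡ rank)) (x∈⁅x⁆ v)))

    ∈-⁅rank⁻¹⁆ : ∀ {v p} → v ∈ ⁅ rank ⟨$⟩ˡ p ⁆ → rank ⟨$⟩ʳ v ≡ p
    ∈-⁅rank⁻¹⁆ {v} {p} v∈⁅⁆ = trans (cong (rank ⟨$⟩ʳ_) (x∈⁅y⁆⇒x≡y _ v∈⁅⁆)) (inverseʳ rank)

    layoutBag⇒rank≤ : ∀ {v p} → v ∈ layoutBag p → rank ⟨$⟩ʳ v ≤ p
    layoutBag⇒rank≤ v∈p with x∈p∪q⁻ _ _ v∈p
    ... | inj₁ v∈⁅⁆   = ≤-reflexive (∈-⁅rank⁻¹⁆ v∈⁅⁆)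
    ... | inj₂ v∈act = ℕ.<⇒≤ (active⇒rank< v∈act)

    layoutBag⇒active : ∀ {v p} → rank ⟨$⟩ʳ v < p → v ∈ layoutBag p → v ∈ active p
    layoutBag⇒active v<p v∈p with x∈p∪q⁻ _ _ v∈p
    ... | inj₁ v∈⁅⁆   = ⊥-elim (<-irrefl (∈-⁅rank⁻¹⁆ v∈⁅⁆) v<p)
    ... | inj₂ v∈act = v∈act

    edgeIn-layout : ∀ u v → Adj G u v → ∃ λ p → u ∈ layoutBag p × v ∈ layoutBag p
    edgeIn-layout u v e with <-cmp (rank ⟨$⟩ʳ u) (rank ⟨$⟩ʳ v)
    ... | tri< u<v _ _ = rank ⟨$⟩ʳ v , x∈p∪q⁺ (inj₂ (edge⇒active e u<v)) , ∈-layoutBag v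
    ... | tri> _ _ v<u = rank ⟨$⟩ʳ u , ∈-layoutBag u , x∈p∪q⁺ (inj₂ (edge⇒active (Graph.sym G e) v<u))
    ... | tri≈ _ ru≡rv _ = ⊥-elim (Graph.irrefl G (subst (Adj G u) (sym u≡v) e))
      where
      u≡v : u ≡ v
      u≡v = trans (sym (inverseˡ rank)) (trans (cong (rank ⟨$⟩ˡ_) ru≡rv) (inverseˡ rank))

    interval-layout : ∀ v (i j l : Fin n) → i ≤ j → j ≤ l → v ∈ layoutBag i → v ∈ layoutBag l → v ∈ layoutBag j
    interval-layout v i j l i≤j j≤l v∈i v∈l with rank ⟨$⟩ʳ v ≟ j
    ... | yes refl = ∈-layoutBag v
    ... | no  v≢j  = x∈p∪q⁺ (inj₂ (active-interval v<j j≤l (layoutBag⇒active (ℕ.<-≤-trans v<j j≤l) v∈l)))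
      where
      v<j : rank ⟨$⟩ʳ v < j
      v<j = ≤∧≢⇒< (≤-trans (layoutBag⇒rank≤ v∈i) i≤j) v≢j

    ∣layoutBag∣≤ : ∀ p → ∣ layoutBag p ∣ ℕ.≤ suc w
    ∣layoutBag∣≤ p = begin
      ∣ ⁅ rank ⟨$⟩ˡ p ⁆ ∪ active p ∣        ≤⟨ ∣p∪q∣≤∣p∣+∣q∣ ⁅ rank ⟨$⟩ˡ p ⁆ (active p) ⟩
      ∣ ⁅ rank ⟨$⟩ˡ p ⁆ ∣ + ∣ active p ∣    ≡⟨ cong (_+ ∣ active p ∣) (∣⁅x⁆∣≡1 (rank ⟨$⟩ˡ p)) ⟩
      suc ∣ active p ∣                      ≤⟨ ℕ.s≤s (∣active∣≤ p) ⟩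
      suc w                                 ∎
      where open ℕ.≤-Reasoning

  linearLayout⇒pathwidth : PathwidthAtMost G w
  linearLayout⇒pathwidth = record
    { m        = n
    ; bag      = layoutBag
    ; covers   = λ v → rank ⟨$⟩ʳ v , ∈-layoutBag v
    ; edgeIn   = edgeIn-layout
    ; interval = interval-layout
    } , ∣layoutBag∣≤

module _ {G₁ G₂ : Graph n} {k t : ℕ} (L₁ : LinearLayout G₁ k) (L₂ : LinearLayout G₂ t) where

  open LinearLayout L₁ renaming (rank to rank₁; active to active₁; active⇒rank< to active₁⇒rank<;
    edge⇒active to edge⇒active₁; active-interval to active₁-interval; ∣active∣≤ to ∣active₁∣≤)
  open LinearLayout L₂ renaming (rank to rank₂; active to active₂; active⇒rank< to active₂⇒rank<;
    edge⇒active to edge⇒active₂; active-interval to active₂-interval; ∣active∣≤ to ∣active₂∣≤)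

  alignment : Permutation′ n
  alignment = rank₁ ∘ₚ Perm.flip rank₂

  private
    φ : Permutation′ n
    φ = alignment

    rank₂∘φ : ∀ i → rank₂ ⟨$⟩ʳ (φ ⟨$⟩ʳ i) ≡ rank₁ ⟨$⟩ʳ i
    rank₂∘φ i = inverseʳ rank₂

    rank₁∘φ⁻¹ : ∀ v → rank₁ ⟨$⟩ʳ (φ ⟨$⟩ˡ v) ≡ rank₂ ⟨$⟩ʳ v
    rank₁∘φ⁻¹ v = trans (sym (rank₂∘φ (φ ⟨$⟩ˡ v))) (cong (rank₂ ⟨$⟩ʳ_) (inverseʳ φ))

    active : Fin n → Subset n
    active p = preimage (φ ⟨$⟩ˡ_) (active₁ p) ∪ active₂ p

    active⇒rank< : ∀ {v p} → v ∈ active p → rank₂ ⟨$⟩ʳ v < p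
    active⇒rank< v∈p with x∈p∪q⁻ _ _ v∈p
    ... | inj₁ v∈₁ = subst (_< _) (rank₁∘φ⁻¹ _) (active₁⇒rank< (∈-preimage⁻ v∈₁))
    ... | inj₂ v∈₂ = active₂⇒rank< v∈₂

    edge⇒active : ∀ {u v} → Adj (unionAlong G₁ G₂ φ) u v → rank₂ ⟨$⟩ʳ u < rank₂ ⟨$⟩ʳ v → u ∈ active (rank₂ ⟨$⟩ʳ v)
    edge⇒active (inj₂ e) u<v = x∈p∪q⁺ (inj₂ (edge⇒active₂ e u<v))
    edge⇒active (inj₁ (i , j , e , refl , refl)) u<v rewrite rank₂∘φ i | rank₂∘φ j =
      x∈p∪q⁺ (inj₁ (∈-preimage⁺ (subst (_∈ active₁ _) (sym (inverseˡ φ)) (edge⇒active₁ e u<v))))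

    active-interval : ∀ {v j l} → rank₂ ⟨$⟩ʳ v < j → j ≤ l → v ∈ active l → v ∈ active j
    active-interval v<j j≤l v∈l with x∈p∪q⁻ _ _ v∈l
    ... | inj₁ v∈₁ = x∈p∪q⁺ (inj₁ (∈-preimage⁺
          (active₁-interval (subst (_< _) (sym (rank₁∘φ⁻¹ _)) v<j) j≤l (∈-preimage⁻ v∈₁))))
    ... | inj₂ v∈₂ = x∈p∪q⁺ (inj₂ (active₂-interval v<j j≤l v∈₂))

    ∣active∣≤ : ∀ p → ∣ active p ∣ ℕ.≤ k + t
    ∣active∣≤ p = begin
      ∣ preimage (φ ⟨$⟩ˡ_) (active₁ p) ∪ active₂ p ∣        ≤⟨ ∣p∪q∣≤∣p∣+∣q∣ (preimage (φ ⟨$⟩ˡ_) (active₁ p)) (active₂ p) ⟩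
      ∣ preimage (φ ⟨$⟩ˡ_) (active₁ p) ∣ + ∣ active₂ p ∣    ≡⟨ cong (_+ ∣ active₂ p ∣) (∣preimage∣ (Perm.flip φ) (active₁ p)) ⟩
      ∣ active₁ p ∣ + ∣ active₂ p ∣                         ≤⟨ ℕ.+-mono-≤ (∣active₁∣≤ p) (∣active₂∣≤ p) ⟩
      k + t                                                 ∎
      where open ℕ.≤-Reasoning

  unionAlong-linearLayout : LinearLayout (unionAlong G₁ G₂ alignment) (k + t)
  unionAlong-linearLayout = record
    { rank            = rank₂
    ; active          = active
    ; active⇒rank<    = active⇒rank<
    ; edge⇒active     = edge⇒active
    ; active-interval = active-interval
    ; ∣active∣≤       = ∣active∣≤
    }

pathwidth-unionAlong : ∀ {k t} {G₁ G₂ : Graph n} → PathwidthAtMost G₁ k → PathwidthAtMost G₂ t →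
  ∃ λ (φ : Permutation′ n) → PathwidthAtMost (unionAlong G₁ G₂ φ) (k + t)
pathwidth-unionAlong (D₁ , D₁-width) (D₂ , D₂-width) =
  alignment L₁ L₂ , linearLayout⇒pathwidth (unionAlong-linearLayout L₁ L₂)
  where
  L₁ = pathDecomposition⇒linearLayout D₁ D₁-width
  L₂ = pathDecomposition⇒linearLayout D₂ D₂-width

lemma2 : ∀ (n k t : ℕ) (G₁ G₂ : Graph n) → HasPathwidth G₁ k → HasPathwidth G₂ t →
    ∃ λ (φ : Permutation′ n) → PathwidthAtMost (unionAlong G₁ G₂ φ) (k + t)
lemma2 n k t G₁ G₂ (pw₁ , _) (pw₂ , _) = pathwidth-unionAlong pw₁ pw₂
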